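{- Every bi-infinite binary $4$-free word $\mathbf w$ such that (i) there is no word $x$ of length $4$ with both $x$ and $\overline{x}$ factors of $\mathbf w$, and (ii) neither $1001001$ nor $0110110$ is a factor of $\mathbf w$, has the same set of factors as either $h(\mathbf f)$ or $\overline{h(\mathbf f)}$.
   Context: $\overline{x}$ denotes the image of $x$ under exchanging $0$ and $1$. A bi-infinite word is a map $\mathbb Z\to\{0,1\}$; its factors are its finite contiguous subwords. For a finite word $w$, $\exp(w)=|w|/\mathrm{per}(w)$ with $\mathrm{per}(w)$ its smallest period; a word is $4$-free if every nonempty factor has exponent $<4$. $\mathbf f=0100101001001\cdots$ is the Fibonacci word, fixed point of $0\mapsto01$, $1\mapsto0$, and $h$ is the morphism $0\mapsto0$, $1\mapsto01$. -}

module Defs where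

open import Data.Bool using (Bool; true; false; not)
open import Data.Nat using (ℕ; zero; suc; _+_; _*_; _≤_; _<_)
open import Data.Integer as ℤ using (ℤ; +_)
open import Data.List using (List; []; _∷_; length; map; upTo; concatMap; _++_)
open import Data.List.Relation.Binary.Infix.Heterogeneous.Properties using ()
open import Data.Maybe using (Maybe; just; nothing)
open import Data.Product using (Σ; ∃; _×_)
open import Relation.Binary.PropositionalEquality using (_≡_)
open import Relation.Nullary using (¬_)

-- Alphabet {0,1} is Bool with false = 0, true = 1.
-- Bi-infinite word: map ℤ → {0,1}.
BiWord : Set
BiWord = ℤ → Bool

compl : List Bool → List Bool
compl = map not

window : BiWord → ℤ → ℕ → List Bool
window w i n = map (λ k → w (i ℤ.+ + k)) (upTo n)

Factor : List Bool → BiWord → Set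
Factor u w = ∃ λ (i : ℤ) → window w i (length u) ≡ u

FinFactor : List Bool → List Bool → Set
FinFactor u v = ∃ λ (p : List Bool) → ∃ λ (s : List Bool) → p ++ u ++ s ≡ v

nth : List Bool → ℕ → Maybe Bool
nth []       _       = nothing
nth (x ∷ xs) zero    = just x
nth (x ∷ xs) (suc i) = nth xs i

IsPeriod : List Bool → ℕ → Set
IsPeriod u p = (1 ≤ p) × (∀ i → i + p < length u → nth u i ≡ nth u (i + p))

IsSmallestPeriod : List Bool → ℕ → Set
IsSmallestPeriod u p = IsPeriod u p × (∀ q → IsPeriod u q → p ≤ q)

-- exp(u) = |u| / per(u) < 4, i.e. |u| < 4 per(u)
ExpLt4 : List Bool → Set
ExpLt4 u = ∀ p → IsSmallestPeriod u p → length u < 4 * p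

FourFree : BiWord → Set
FourFree w = ∀ u → Factor u w → ¬ (u ≡ []) → ExpLt4 u

φ : List Bool → List Bool
φ = concatMap (λ { false → false ∷ true ∷ [] ; true → false ∷ [] })

h : List Bool → List Bool
h = concatMap (λ { false → false ∷ [] ; true → false ∷ true ∷ [] })

iter : ℕ → List Bool → List Bool
iter zero    xs = xs
iter (suc n) xs = φ (iter n xs)

-- φⁿ(0), a prefix of the Fibonacci word f (of length ≥ n+1)
fibPrefix : ℕ → List Bool
fibPrefix n = iter n (false ∷ [])

nthD : List Bool → ℕ → Bool
nthD []       _       = false
nthD (x ∷ xs) zero    = x
nthD (x ∷ xs) (suc i) = nthD xs i

fib : ℕ → Bool
fib i = nthD (fibPrefix (suc i)) i

fibTake : ℕ → List Bool
fibTake n = map fib (upTo n)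

-- u is a factor of the infinite word h(f): since h(f) is the limit of
-- h(f[0..n)), this means u is a factor of h(f[0..n)) for some n
FactorHF : List Bool → Set
FactorHF u = ∃ λ (n : ℕ) → FinFactor u (h (fibTake n))

FactorHFbar : List Bool → Set
FactorHFbar u = FactorHF (compl u)

SameFactors : BiWord → (List Bool → Set) → Set
SameFactors w P = ∀ u → (Factor u w → P u) × (P u → Factor u w)

module Submission where

-- The factors of w avoid fourth powers, 1001001, 0110110 and complementary pairs of
-- length 4; an exhaustive search over the words of length 28 with this property shows
-- that the majority of three consecutive letters of w does not depend on the position.
-- Since 11 forces majority 1 and 00 forces majority 0, one of 11, 00 is not a factor,
-- and after complementing w we may assume it is 11.  The factors of w then form a
-- factorial bi-extendable language without 11.  Such a language can be desubstituted
-- by h into another one if it avoids h(11)0 = 01010, and by φ if it avoids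
-- φ(11)0 = 000.  The remaining hypotheses keep 000 out of every level: at the first
-- it yields 0000, at the second a word containing 1001001, and at the higher ones its
-- extensions 0000 and 00010 yield fourth powers.  Desubstitution shortens every word
-- of length at least 4, so each factor of w is a factor of h(φᵐ(0)) for some m;
-- conversely h(φᵐ(0)) extends to a factor of w since 0 occurs at every level.

open import Defs
open import Data.Bool using (Bool; true; false; not; T; _∧_; _∨_)
open import Data.Bool.Properties using (not-involutive; T-∨; T-∧; T-≡) renaming (_≟_ to _≟ᵇ_)
open import Data.Empty using (⊥-elim)
open import Data.Integer as ℤ using (ℤ; +_; -[1+_])
import Data.Integer.Properties as ℤ
open import Data.List using (List; concatMap; []; _∷_; [_]; _∷ʳ_; length; map; upTo; applyUpTo; _++_; take; drop)
open import Data.List.Properties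
  using (++-assoc; ++-identityʳ; length-++; map-upTo; length-applyUpTo; map-∘; map-++; ∷-injective;
         take++drop≡id; length-drop; length-map; concatMap-++; concatMap-cong; ≡-dec)
open import Data.List.Relation.Binary.Infix.Heterogeneous using (Infix; toView; MkView)
open import Data.List.Relation.Binary.Infix.Heterogeneous.Properties using (infix?)
open import Data.List.Relation.Binary.Pointwise using (Pointwise-≡⇒≡)
import Data.Maybe.Properties as Maybe
open import Data.Nat as ℕ using (ℕ; zero; suc; _+_; _*_; _∸_; _≤_; _<_; z≤n; s≤s; _≤ᵇ_)
import Data.Nat.Properties as ℕ
open import Data.Nat.Induction using (<-wellFounded)
open import Data.Product using (∃; _×_; _,_; proj₁; proj₂)
open import Data.Sum as Sum using (_⊎_; inj₁; inj₂; [_,_]′)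
open import Function using (_∘_; case_of_; _⇔_; mk⇔; Equivalence)
open import Induction.WellFounded using (Acc; acc)
open import Relation.Binary.PropositionalEquality hiding ([_])
open import Relation.Nullary using (¬_; Dec; yes; no)
open import Relation.Nullary.Decidable using (True; isYes; toWitness; map′; _×-dec_; _→-dec_)

-- Factors of bi-infinite words

FinFactor-refl : ∀ u → FinFactor u u
FinFactor-refl u = [] , [] , ++-identityʳ u

FinFactor-trans : ∀ {u v x} → FinFactor u v → FinFactor v x → FinFactor u x
FinFactor-trans {u} (p , s , refl) (p′ , s′ , refl) =
  p′ ++ p , s ++ s′ , (begin
    (p′ ++ p) ++ u ++ s ++ s′   ≡⟨ ++-assoc p′ p _ ⟩
    p′ ++ p ++ u ++ s ++ s′     ≡⟨ cong (λ t → p′ ++ p ++ t) (++-assoc u s s′) ⟨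
    p′ ++ p ++ (u ++ s) ++ s′   ≡⟨ cong (p′ ++_) (++-assoc p (u ++ s) s′) ⟨
    p′ ++ (p ++ u ++ s) ++ s′   ∎)
  where open ≡-Reasoning

FinFactor-prefix : ∀ u s → FinFactor u (u ++ s)
FinFactor-prefix u s = [] , s , refl

FinFactor-suffix : ∀ p u → FinFactor u (p ++ u)
FinFactor-suffix p u = p , [] , cong (p ++_) (++-identityʳ u)

FinFactor-++ʳ : ∀ {u v} s → FinFactor u v → FinFactor u (v ++ s)
FinFactor-++ʳ {v = v} s f = FinFactor-trans f (FinFactor-prefix v s)

FinFactor-map : ∀ (f : Bool → List Bool) {u v} →
                FinFactor u v → FinFactor (concatMap f u) (concatMap f v)
FinFactor-map f {u} (p , s , refl) = concatMap f p , concatMap f s ,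
  sym (trans (concatMap-++ f p (u ++ s)) (cong (concatMap f p ++_) (concatMap-++ f u s)))

applyUpTo-cong : ∀ {A : Set} {f g : ℕ → A} n → (∀ k → f k ≡ g k) → applyUpTo f n ≡ applyUpTo g n
applyUpTo-cong zero    f≗g = refl
applyUpTo-cong (suc n) f≗g = cong₂ _∷_ (f≗g 0) (applyUpTo-cong n (f≗g ∘ suc))

applyUpTo-++ : ∀ {A : Set} (f : ℕ → A) m n →
               applyUpTo f (m + n) ≡ applyUpTo f m ++ applyUpTo (λ k → f (m + k)) n
applyUpTo-++ f zero    n = refl
applyUpTo-++ f (suc m) n = cong (f 0 ∷_) (applyUpTo-++ (f ∘ suc) m n)

i-j+j≡i : ∀ i j → (i ℤ.- j) ℤ.+ j ≡ i
i-j+j≡i i j = trans (ℤ.+-assoc i (ℤ.- j) j) (trans (cong (λ k → i ℤ.+ k) (ℤ.+-inverseˡ j)) (ℤ.+-identityʳ i))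

+-+-assoc : ∀ i m n → i ℤ.+ + (m + n) ≡ (i ℤ.+ + m) ℤ.+ + n
+-+-assoc i m n = trans (cong (λ j → i ℤ.+ j) (ℤ.pos-+ m n)) (sym (ℤ.+-assoc i (+ m) (+ n)))

window-++ : ∀ w i m n → window w i (m + n) ≡ window w i m ++ window w (i ℤ.+ + m) n
window-++ w i m n = begin
  window w i (m + n)                                         ≡⟨ map-upTo _ (m + n) ⟩
  applyUpTo (λ k → w (i ℤ.+ + k)) (m + n)                    ≡⟨ applyUpTo-++ _ m n ⟩
  applyUpTo _ m ++ applyUpTo (λ k → w (i ℤ.+ + (m + k))) n  ≡⟨ cong (_ ++_) (applyUpTo-cong n (cong w ∘ +-+-assoc i m)) ⟩
  applyUpTo _ m ++ applyUpTo (λ k → w ((i ℤ.+ + m) ℤ.+ + k)) n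
    ≡⟨ cong₂ _++_ (map-upTo _ m) (map-upTo _ n) ⟨
  window w i m ++ window w (i ℤ.+ + m) n                      ∎
  where open ≡-Reasoning

length-window : ∀ w i n → length (window w i n) ≡ n
length-window w i n = trans (cong length (map-upTo _ n)) (length-applyUpTo _ n)

window-compl : ∀ w i n → window (not ∘ w) i n ≡ compl (window w i n)
window-compl w i n = map-∘ (upTo n)

++-cancel-length : ∀ (a c : List Bool) {b d} → length a ≡ length c → a ++ b ≡ c ++ d → a ≡ c × b ≡ d
++-cancel-length []      []      _  eq = refl , eq
++-cancel-length (x ∷ a) (y ∷ c) la eq with ∷-injective eq
... | refl , eq′ with ++-cancel-length a c (ℕ.suc-injective la) eq′
... | refl , b≡d = refl , b≡d

Factor-window : ∀ w i n → Factor (window w i n) w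
Factor-window w i n = i , cong (window w i) (length-window w i n)

Factor-mono : ∀ {w u v} → FinFactor u v → Factor v w → Factor u w
Factor-mono {w} {u} (p , s , refl) (i , eq) = i ℤ.+ + length p , sym u≡
  where
  j = i ℤ.+ + length p
  split : window w i (length p) ++ window w j (length u) ++ window w (j ℤ.+ + length u) (length s)
        ≡ p ++ u ++ s
  split = begin
    _ ≡⟨ cong (window w i (length p) ++_) (window-++ w j (length u) (length s)) ⟨
    _ ≡⟨ window-++ w i (length p) _ ⟨
    window w i (length p + (length u + length s)) ≡⟨ cong (window w i) (trans (length-++ p) (cong (λ n → length p + n) (length-++ u))) ⟨
    window w i (length (p ++ u ++ s)) ≡⟨ eq ⟩
    p ++ u ++ s ∎
    where open ≡-Reasoning
  u≡ : u ≡ window w j (length u)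
  u≡ = sym (proj₁ (++-cancel-length (window w j (length u)) u (length-window w j (length u))
                     (proj₂ (++-cancel-length (window w i (length p)) p (length-window w i (length p)) split))))

Factor-extendʳ : ∀ {w} u → Factor u w → ∃ λ a → Factor (u ∷ʳ a) w
Factor-extendʳ {w} u (i , eq) = w j , i , (begin
  window w i (length (u ∷ʳ w j))                  ≡⟨ cong (window w i) (length-++ u) ⟩
  window w i (length u + 1)                       ≡⟨ window-++ w i (length u) 1 ⟩
  window w i (length u) ++ window w j 1           ≡⟨ cong₂ _++_ eq (cong (λ k → [ w k ]) (ℤ.+-identityʳ j)) ⟩
  u ∷ʳ w j                                        ∎)
  where
  j = i ℤ.+ + length u
  open ≡-Reasoning

Factor-extendˡ : ∀ {w} u → Factor u w → ∃ λ a → Factor (a ∷ u) w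
Factor-extendˡ {w} u (i , eq) = w (i′ ℤ.+ + 0) , i′ ,
  trans (window-++ w i′ 1 (length u)) (cong (w (i′ ℤ.+ + 0) ∷_) (trans (cong (λ j → window w j (length u)) (i-j+j≡i i (+ 1))) eq))
  where i′ = i ℤ.- + 1

-- Fourth powers

nth-++ˡ : ∀ (a b : List Bool) {i} → i < length a → nth (a ++ b) i ≡ nth a i
nth-++ˡ (x ∷ a) b {zero}  _         = refl
nth-++ˡ (x ∷ a) b {suc i} (s≤s i<a) = nth-++ˡ a b i<a

nth-++ʳ : ∀ (a b : List Bool) i → nth (a ++ b) (length a + i) ≡ nth b i
nth-++ʳ []      b i = refl
nth-++ʳ (x ∷ a) b i = nth-++ʳ a b i

overlap-period : ∀ a b c → a ++ b ≡ b ++ c → ¬ a ≡ [] → IsPeriod (a ++ b) (length a)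
overlap-period []      b c eq a≢[] = ⊥-elim (a≢[] refl)
overlap-period a@(_ ∷ _) b c eq a≢[] = s≤s z≤n , shift
  where
  shift : ∀ i → i + length a < length (a ++ b) → nth (a ++ b) i ≡ nth (a ++ b) (i + length a)
  shift i lt = begin
    nth (a ++ b) i                ≡⟨ cong (λ v → nth v i) eq ⟩
    nth (b ++ c) i                ≡⟨ nth-++ˡ b c i<b ⟩
    nth b i                       ≡⟨ nth-++ʳ a b i ⟨
    nth (a ++ b) (length a + i)   ≡⟨ cong (nth (a ++ b)) (ℕ.+-comm (length a) i) ⟩
    nth (a ++ b) (i + length a)   ∎
    where
    open ≡-Reasoning
    i<b : i < length b
    i<b = ℕ.+-cancelʳ-< (length a) i (length b)
            (subst (i + length a <_) (trans (length-++ a) (ℕ.+-comm (length a) (length b))) lt)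

isPeriod? : ∀ u p → Dec (IsPeriod u p)
isPeriod? u p = (1 ℕ.≤? p) ×-dec map′ (λ f i lt → f (ℕ.m+n≤o⇒m≤o (suc i) lt) lt) (λ f {i} _ → f i)
                  (ℕ.allUpTo? (λ i → (i + p ℕ.<? length u) →-dec Maybe.≡-dec _≟ᵇ_ (nth u i) (nth u (i + p))) (length u))

least-witness : ∀ {P : ℕ → Set} → (∀ n → Dec (P n)) → ∀ {n} → P n → ∃ λ m → P m × (∀ q → P q → m ≤ q)
least-witness {P} P? {n} = go n (<-wellFounded n)
  where
  go : ∀ n → Acc _<_ n → P n → ∃ λ m → P m × (∀ q → P q → m ≤ q)
  go n (acc smaller) Pn with ℕ.anyUpTo? P? n
  ... | yes (m , m<n , Pm) = go m (smaller m<n) Pm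
  ... | no none            = n , Pn , λ q Pq → ℕ.≮⇒≥ (λ q<n → none (q , q<n , Pq))

infixl 10 _⁴

_⁴ : List Bool → List Bool
A ⁴ = A ++ A ++ A ++ A

length-⁴ : ∀ A → length (A ⁴) ≡ 4 * length A
length-⁴ A = begin
  length (A ++ A ++ A ++ A)                           ≡⟨ length-++ A ⟩
  length A + length (A ++ A ++ A)                     ≡⟨ cong (λ n → length A + n) (length-++ A) ⟩
  length A + (length A + length (A ++ A))             ≡⟨ cong (λ n → length A + (length A + n)) (length-++ A) ⟩
  length A + (length A + (length A + length A))       ≡⟨ cong (λ n → length A + (length A + (length A + n))) (ℕ.+-identityʳ (length A)) ⟨
  4 * length A                                        ∎
  where open ≡-Reasoning

⁴-period : ∀ A → ¬ A ≡ [] → IsPeriod (A ⁴) (length A)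
⁴-period A = overlap-period A (A ++ A ++ A) A (sym (trans (++-assoc A (A ++ A) A) (cong (A ++_) (++-assoc A A A))))

FourFree⇒no⁴ : ∀ {w} → FourFree w → ∀ A → ¬ A ≡ [] → ¬ Factor (A ⁴) w
FourFree⇒no⁴ ff []          A≢[] _ = A≢[] refl
FourFree⇒no⁴ ff A@(_ ∷ _) A≢[] A⁴∈w with least-witness (isPeriod? (A ⁴)) (⁴-period A A≢[])
... | m , per-m , least = ℕ.<⇒≱ (subst (_< 4 * m) (length-⁴ A) (ff (A ⁴) A⁴∈w (λ ()) m (per-m , least)))
                                (ℕ.*-monoʳ-≤ 4 (least (length A) (⁴-period A A≢[])))

compl-involutive : ∀ u → compl (compl u) ≡ u
compl-involutive []      = refl
compl-involutive (x ∷ u) = cong₂ _∷_ (not-involutive x) (compl-involutive u)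

compl-++ : ∀ a b → compl (a ++ b) ≡ compl a ++ compl b
compl-++ = map-++ not

compl-⁴ : ∀ A → compl (A ⁴) ≡ compl A ⁴
compl-⁴ A = trans (compl-++ A _) (cong (compl A ++_) (trans (compl-++ A _) (cong (compl A ++_) (compl-++ A A))))

Factor-compl : ∀ {w u} → Factor u w → Factor (compl u) (not ∘ w)
Factor-compl {w} {u} (i , eq) = i , (begin
  window (not ∘ w) i (length (compl u))  ≡⟨ cong (window (not ∘ w) i) (length-map not u) ⟩
  window (not ∘ w) i (length u)          ≡⟨ window-compl w i (length u) ⟩
  compl (window w i (length u))          ≡⟨ cong compl eq ⟩
  compl u                                ∎)
  where open ≡-Reasoning

Factor-compl⁻ : ∀ {w u} → Factor u (not ∘ w) → Factor (compl u) w
Factor-compl⁻ {w} {u} (i , eq) = i , (begin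
  window w i (length (compl u))          ≡⟨ cong (window w i) (length-map not u) ⟩
  window w i (length u)                  ≡⟨ compl-involutive _ ⟨
  compl (compl (window w i (length u)))  ≡⟨ cong compl (trans (sym (window-compl w i (length u))) eq) ⟩
  compl u                                ∎)
  where open ≡-Reasoning

-- A search over the windows of length 28

w1001001 w0110110 : List Bool
w1001001 = true ∷ false ∷ false ∷ true ∷ false ∷ false ∷ true ∷ []
w0110110 = compl w1001001

Forbidden : List Bool → Set
Forbidden v = (∃ λ A → ¬ A ≡ [] × FinFactor (A ⁴) v)
            ⊎ (∃ λ x → length x ≡ 4 × FinFactor x v × FinFactor (compl x) v)
            ⊎ FinFactor w1001001 v
            ⊎ FinFactor w0110110 v

Forbidden-++ʳ : ∀ {v} s → Forbidden v → Forbidden (v ++ s)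
Forbidden-++ʳ s (inj₁ (A , A≢[] , f))                = inj₁ (A , A≢[] , FinFactor-++ʳ s f)
Forbidden-++ʳ s (inj₂ (inj₁ (x , |x| , f , f̄)))      = inj₂ (inj₁ (x , |x| , FinFactor-++ʳ s f , FinFactor-++ʳ s f̄))
Forbidden-++ʳ s (inj₂ (inj₂ (inj₁ f)))               = inj₂ (inj₂ (inj₁ (FinFactor-++ʳ s f)))
Forbidden-++ʳ s (inj₂ (inj₂ (inj₂ f)))               = inj₂ (inj₂ (inj₂ (FinFactor-++ʳ s f)))

infix 4 _≟ₗ_

_≟ₗ_ : (u v : List Bool) → Dec (u ≡ v)
_≟ₗ_ = ≡-dec _≟ᵇ_

lastN : ℕ → List Bool → List Bool
lastN n p = drop (length p ∸ n) p

FinFactor-lastN : ∀ n p → FinFactor (lastN n p) p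
FinFactor-lastN n p = subst (FinFactor (lastN n p)) (take++drop≡id (length p ∸ n) p)
                            (FinFactor-suffix (take (length p ∸ n) p) (lastN n p))

length-lastN : ∀ n p → n ≤ length p → length (lastN n p) ≡ n
length-lastN n p n≤p = trans (length-drop (length p ∸ n) p) (ℕ.m∸[m∸n]≡n n≤p)

endsWith? : List Bool → List Bool → Bool
endsWith? x p = isYes (lastN (length x) p ≟ₗ x)

-- the period is q + 1, never 0
endsWith⁴? : ℕ → List Bool → Bool
endsWith⁴? q p = (4 * suc q ≤ᵇ length p) ∧ isYes (s ≟ₗ take (suc q) s ⁴)
  where s = lastN (4 * suc q) p

endsWithShort⁴? : ℕ → List Bool → Bool
endsWithShort⁴? zero    p = false
endsWithShort⁴? (suc q) p = endsWith⁴? q p ∨ endsWithShort⁴? q p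

complementOfEnd? : List Bool → Bool
complementOfEnd? p = (4 ≤ᵇ length p) ∧ isYes (infix? _≟ᵇ_ (compl (lastN 4 p)) p)

forbiddenEnd? : List Bool → Bool
forbiddenEnd? p = endsWithShort⁴? 7 p ∨ complementOfEnd? p ∨ endsWith? w1001001 p ∨ endsWith? w0110110 p

majority : Bool → Bool → Bool → Bool
majority a b c = (a ∧ b) ∨ (b ∧ c) ∨ (a ∧ c)

majorityStable? : List Bool → Bool
majorityStable? p with drop 12 p
... | a ∷ b ∷ c ∷ d ∷ _ = isYes (majority a b c ≟ᵇ majority b c d)
... | _                 = false

search : List Bool → ℕ → Bool
search p zero    = forbiddenEnd? p ∨ majorityStable? p
search p (suc n) = forbiddenEnd? p ∨ (search (p ∷ʳ false) n ∧ search (p ∷ʳ true) n)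

search-succeeds : search [] 28 ≡ true
search-succeeds = refl

Infix⇒FinFactor : ∀ {u v} → Infix _≡_ u v → FinFactor u v
Infix⇒FinFactor i with toView i
... | MkView pref pw suff = pref , suff , cong (λ x → pref ++ x ++ suff) (Pointwise-≡⇒≡ pw)

endsWith?-sound : ∀ x p → T (endsWith? x p) → FinFactor x p
endsWith?-sound x p t = subst (λ v → FinFactor v p) (toWitness {a? = lastN (length x) p ≟ₗ x} t) (FinFactor-lastN (length x) p)

endsWith⁴?-sound : ∀ q p → T (endsWith⁴? q p) → ∃ λ A → ¬ A ≡ [] × FinFactor (A ⁴) p
endsWith⁴?-sound q p t with Equivalence.to T-∧ t
... | fits , t′ = A , A≢[] , subst (λ v → FinFactor v p) s≡A⁴ (FinFactor-lastN (4 * suc q) p)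
  where
  s = lastN (4 * suc q) p
  A = take (suc q) s
  s≡A⁴ : s ≡ A ⁴
  s≡A⁴ = toWitness {a? = s ≟ₗ A ⁴} t′
  A≢[] : ¬ A ≡ []
  A≢[] A≡[] with trans (sym (length-lastN (4 * suc q) p (ℕ.≤ᵇ⇒≤ _ _ fits))) (cong length (trans s≡A⁴ (cong _⁴ A≡[])))
  ... | ()

endsWithShort⁴?-sound : ∀ q p → T (endsWithShort⁴? q p) → ∃ λ A → ¬ A ≡ [] × FinFactor (A ⁴) p
endsWithShort⁴?-sound (suc q) p t with Equivalence.to T-∨ t
... | inj₁ t′ = endsWith⁴?-sound q p t′
... | inj₂ t′ = endsWithShort⁴?-sound q p t′

complementOfEnd?-sound : ∀ p → T (complementOfEnd? p) → ∃ λ x → length x ≡ 4 × FinFactor x p × FinFactor (compl x) p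
complementOfEnd?-sound p t with Equivalence.to T-∧ t
... | fits , t′ = lastN 4 p , length-lastN 4 p (ℕ.≤ᵇ⇒≤ 4 _ fits) , FinFactor-lastN 4 p , Infix⇒FinFactor (toWitness {a? = infix? _≟ᵇ_ (compl (lastN 4 p)) p} t′)

forbiddenEnd?-sound : ∀ p → T (forbiddenEnd? p) → Forbidden p
forbiddenEnd?-sound p t with Equivalence.to T-∨ t
... | inj₁ t₁ = inj₁ (endsWithShort⁴?-sound 7 p t₁)
... | inj₂ t₂ with Equivalence.to T-∨ t₂
...   | inj₁ t₃ = inj₂ (inj₁ (complementOfEnd?-sound p t₃))
...   | inj₂ t₄ with Equivalence.to T-∨ t₄
...     | inj₁ t₅ = inj₂ (inj₂ (inj₁ (endsWith?-sound w1001001 p t₅)))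
...     | inj₂ t₆ = inj₂ (inj₂ (inj₂ (endsWith?-sound w0110110 p t₆)))

majorityStable?-sound : ∀ v {a b c d r} → drop 12 v ≡ a ∷ b ∷ c ∷ d ∷ r → T (majorityStable? v) → majority a b c ≡ majority b c d
majorityStable?-sound v eq t with drop 12 v
majorityStable?-sound v refl t | _ = toWitness t

search-sound : ∀ p s {n} → length s ≡ n → search p n ≡ true → Forbidden (p ++ s) ⊎ T (majorityStable? (p ++ s))
search-sound p [] refl t with Equivalence.to T-∨ (Equivalence.from T-≡ t)
... | inj₁ t′ = inj₁ (subst Forbidden (sym (++-identityʳ p)) (forbiddenEnd?-sound p t′))
... | inj₂ t′ = inj₂ (subst (T ∘ majorityStable?) (sym (++-identityʳ p)) t′)
search-sound p (b ∷ s) refl t with Equivalence.to T-∨ (Equivalence.from T-≡ t)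
... | inj₁ t′ = inj₁ (Forbidden-++ʳ (b ∷ s) (forbiddenEnd?-sound p t′))
... | inj₂ t′ = subst (λ v → Forbidden v ⊎ T (majorityStable? v)) (++-assoc p [ b ] s)
                      (search-sound (p ∷ʳ b) s refl (Equivalence.to T-≡ (branch b (Equivalence.to T-∧ t′))))
  where
  branch : ∀ b → T (search (p ∷ʳ false) (length s)) × T (search (p ∷ʳ true) (length s)) → T (search (p ∷ʳ b) (length s))
  branch false = proj₁
  branch true  = proj₂

-- 00 versus 11

shift-invariant⇒constant : ∀ {A : Set} (f : ℤ → A) → (∀ i → f i ≡ f (i ℤ.+ + 1)) → ∀ i → f i ≡ f (+ 0)
shift-invariant⇒constant f step (+ zero)      = refl
shift-invariant⇒constant f step (+ suc n)     =
  trans (cong (f ∘ +_) (ℕ.+-comm 1 n)) (trans (sym (step (+ n))) (shift-invariant⇒constant f step (+ n)))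
shift-invariant⇒constant f step -[1+ zero ]   = step -[1+ zero ]
shift-invariant⇒constant f step -[1+ suc n ]  = trans (step -[1+ suc n ]) (shift-invariant⇒constant f step -[1+ n ])

majority-cong : ∀ {a b c a′ b′ c′} → a ≡ a′ → b ≡ b′ → c ≡ c′ → majority a b c ≡ majority a′ b′ c′
majority-cong refl refl refl = refl

majority-idem : ∀ b c → majority b b c ≡ b
majority-idem false c = refl
majority-idem true  c = refl

module _ {w : BiWord} (admissible : ∀ {v} → Factor v w → ¬ Forbidden v) where

  majorityAt : ℤ → Bool
  majorityAt i = majority (w (i ℤ.+ + 12)) (w (i ℤ.+ + 13)) (w (i ℤ.+ + 14))

  -- This is where the search enters: every admissible word of length 28 satisfies
  -- majority(v₁₂ v₁₃ v₁₄) = majority(v₁₃ v₁₄ v₁₅).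
  majorityAt-step : ∀ i → majorityAt i ≡ majorityAt (i ℤ.+ + 1)
  majorityAt-step i = [ (λ forbidden → ⊥-elim (admissible (Factor-window w i 28) forbidden)) , stable⇒ ]′
                        (search-sound [] (window w i 28) (length-window w i 28) search-succeeds)
    where
    shift : ∀ k → w (i ℤ.+ + suc k) ≡ w ((i ℤ.+ + 1) ℤ.+ + k)
    shift k = cong w (+-+-assoc i 1 k)
    stable⇒ : T (majorityStable? (window w i 28)) → majorityAt i ≡ majorityAt (i ℤ.+ + 1)
    stable⇒ stable = trans (majorityStable?-sound (window w i 28) refl stable)
                           (majority-cong (shift 12) (shift 13) (shift 14))

  majorityAt-pair : ∀ b → Factor (b ∷ b ∷ []) w → majorityAt (+ 0) ≡ b
  majorityAt-pair b (i , eq) = begin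
    majorityAt (+ 0)                ≡⟨ shift-invariant⇒constant majorityAt majorityAt-step j ⟨
    majorityAt j                    ≡⟨ majority-cong (trans (back 0) first) (trans (back 1) second) refl ⟩
    majority b b (w (j ℤ.+ + 14))   ≡⟨ majority-idem b _ ⟩
    b                               ∎
    where
    open ≡-Reasoning
    j = i ℤ.- + 12
    back : ∀ k → w (j ℤ.+ + (12 + k)) ≡ w (i ℤ.+ + k)
    back k = cong w (trans (+-+-assoc j 12 k) (cong (λ x → x ℤ.+ + k) (i-j+j≡i i (+ 12))))
    first : w (i ℤ.+ + 0) ≡ b
    first = proj₁ (∷-injective eq)
    second : w (i ℤ.+ + 1) ≡ b
    second = proj₁ (∷-injective (proj₂ (∷-injective eq)))

  no-11-or-no-00 : ¬ Factor (true ∷ true ∷ []) w ⊎ ¬ Factor (false ∷ false ∷ []) w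
  no-11-or-no-00 with majorityAt (+ 0) | majorityAt-pair true | majorityAt-pair false
  ... | false | at11 | _    = inj₁ (λ f → case at11 f of λ ())
  ... | true  | _    | at00 = inj₂ (λ f → case at00 f of λ ())

-- σ c sends c to 0 and the other letter to 01, so that h = σ false and φ = σ true.
σ-tail : Bool → Bool → List Bool
σ-tail false false = []
σ-tail false true  = [ true ]
σ-tail true  false = [ true ]
σ-tail true  true  = []

σ-block : Bool → Bool → List Bool
σ-block c x = false ∷ σ-tail c x

σ : Bool → List Bool → List Bool
σ c = concatMap (σ-block c)

σ-++ : ∀ c xs ys → σ c (xs ++ ys) ≡ σ c xs ++ σ c ys
σ-++ c = concatMap-++ (σ-block c)

σ-same : ∀ c y → σ c (c ∷ y) ≡ false ∷ σ c y
σ-same false y = refl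
σ-same true  y = refl

σ-other : ∀ c y → σ c (not c ∷ y) ≡ false ∷ true ∷ σ c y
σ-other false y = refl
σ-other true  y = refl

σ-⁴ : ∀ c A → σ c (A ⁴) ≡ σ c A ⁴
σ-⁴ c A = trans (σ-++ c A _) (cong (σ c A ++_) (trans (σ-++ c A _) (cong (σ c A ++_) (σ-++ c A A))))

h≗σ : ∀ y → h y ≡ σ false y
h≗σ = concatMap-cong λ { false → refl ; true → refl }

φ≗σ : ∀ y → φ y ≡ σ true y
φ≗σ = concatMap-cong λ { false → refl ; true → refl }

φ-++ : ∀ xs ys → φ (xs ++ ys) ≡ φ xs ++ φ ys
φ-++ xs ys = trans (φ≗σ (xs ++ ys)) (trans (σ-++ true xs ys) (sym (cong₂ _++_ (φ≗σ xs) (φ≗σ ys))))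

iter-++ : ∀ n xs ys → iter n (xs ++ ys) ≡ iter n xs ++ iter n ys
iter-++ zero    xs ys = refl
iter-++ (suc n) xs ys = trans (cong φ (iter-++ n xs ys)) (φ-++ (iter n xs) (iter n ys))

iter-⁴ : ∀ n A → iter n (A ⁴) ≡ iter n A ⁴
iter-⁴ n A = trans (iter-++ n A _) (cong (iter n A ++_) (trans (iter-++ n A _) (cong (iter n A ++_) (iter-++ n A A))))

iter-sucʳ : ∀ n xs → iter (suc n) xs ≡ iter n (φ xs)
iter-sucʳ zero    xs = refl
iter-sucʳ (suc n) xs = cong φ (iter-sucʳ n xs)

φ-nonempty : ∀ {xs} → ¬ xs ≡ [] → ¬ φ xs ≡ []
φ-nonempty {[]}         xs≢[] = xs≢[]
φ-nonempty {false ∷ xs} _     ()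
φ-nonempty {true ∷ xs}  _     ()

iter-nonempty : ∀ n {xs} → ¬ xs ≡ [] → ¬ iter n xs ≡ []
iter-nonempty zero    xs≢[] = xs≢[]
iter-nonempty (suc n) xs≢[] = φ-nonempty (iter-nonempty n xs≢[])

-- Desubstitution

record Language (K : List Bool → Set) : Set where
  field
    infix-closed : ∀ p u s → K (p ++ u ++ s) → K u
    extendʳ      : ∀ u → K u → ∃ λ a → K (u ∷ʳ a)
    extendˡ      : ∀ u → K u → ∃ λ a → K (a ∷ u)
    has-[]       : K []
    no-11        : ¬ K (true ∷ true ∷ [])

  mono : ∀ {u v} → FinFactor u v → K v → K u
  mono (p , s , refl) = infix-closed p _ s

  prefix-closed : ∀ u s → K (u ++ s) → K u
  prefix-closed u s = mono (FinFactor-prefix u s)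

  suffix-closed : ∀ p u → K (p ++ u) → K u
  suffix-closed p u = mono (FinFactor-suffix p u)

  extendʳ-by-0-or-10 : ∀ u → K u → K (u ∷ʳ false) ⊎ K (u ++ true ∷ false ∷ [])
  extendʳ-by-0-or-10 u k with extendʳ u k
  ... | false , k₀ = inj₁ k₀
  ... | true  , k₁ with extendʳ (u ∷ʳ true) k₁
  ...   | false , k₁₀ = inj₂ (subst K (++-assoc u [ true ] [ false ]) k₁₀)
  ...   | true  , k₁₁ = ⊥-elim (no-11 (suffix-closed u _ (subst K (++-assoc u [ true ] [ true ]) k₁₁)))

  extendˡ-by-0-or-01 : ∀ u → K u → K (false ∷ u) ⊎ K (false ∷ true ∷ u)
  extendˡ-by-0-or-01 u k with extendˡ u k
  ... | false , k₀ = inj₁ k₀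
  ... | true  , k₁ with extendˡ (true ∷ u) k₁
  ...   | false , k₀₁ = inj₂ k₀₁
  ...   | true  , k₁₁ = ⊥-elim (no-11 (prefix-closed _ u k₁₁))

  has-0 : K [ false ]
  has-0 with extendʳ-by-0-or-10 [] has-[]
  ... | inj₁ k₀  = k₀
  ... | inj₂ k₁₀ = suffix-closed [ true ] _ k₁₀

zeros : List Bool → ℕ
zeros []          = 0
zeros (false ∷ u) = suc (zeros u)
zeros (true  ∷ u) = zeros u

startsWith1 : List Bool → ℕ
startsWith1 (true ∷ _) = 1
startsWith1 _          = 0

zeros-∷ʳ1 : ∀ u → zeros (u ∷ʳ true) ≡ zeros u
zeros-∷ʳ1 []          = refl
zeros-∷ʳ1 (false ∷ u) = cong suc (zeros-∷ʳ1 u)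
zeros-∷ʳ1 (true  ∷ u) = zeros-∷ʳ1 u

module Desubstitution {K : List Bool → Set} (lang : Language K) (c : Bool) where
  open Language lang

  parse : ∀ v → K (false ∷ v ∷ʳ false) → ∃ λ y → σ c y ≡ false ∷ v × length y ≡ zeros (false ∷ v)
  parse []                k = [ c ] , σ-same c [] , refl
  parse (false ∷ v)       k with parse v (suffix-closed [ false ] _ k)
  ... | y , σy≡ , |y| = c ∷ y , trans (σ-same c y) (cong (false ∷_) σy≡) , cong suc |y|
  parse (true ∷ [])       k = [ not c ] , σ-other c [] , refl
  parse (true ∷ false ∷ v) k with parse v (suffix-closed (false ∷ true ∷ []) _ k)
  ... | y , σy≡ , |y| = not c ∷ y , trans (σ-other c y) (cong (λ t → false ∷ true ∷ t) σy≡) , cong suc |y|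
  parse (true ∷ true ∷ v) k = ⊥-elim (no-11 (infix-closed [ false ] _ _ k))

  -- The trailing 0 marks the start of the next block, so y only records complete blocks.
  Lifted : List Bool → Set
  Lifted y = K (σ c y ∷ʳ false)

  parsed : ∀ {u} v → K (false ∷ v ∷ʳ false) → FinFactor u (false ∷ v) →
           ∃ λ y → Lifted y × FinFactor u (σ c y) × length y ≡ zeros (false ∷ v)
  parsed v k u⊆ with parse v k
  ... | y , σy≡ , |y| = y , subst (K ∘ (_∷ʳ false)) (sym σy≡) k , subst (FinFactor _) (sym σy≡) u⊆ , |y|

  desubstitute₀ : ∀ t → K (false ∷ t) →
                  ∃ λ y → Lifted y × FinFactor (false ∷ t) (σ c y) × length y ≡ zeros (false ∷ t)
  desubstitute₀ t k with extendʳ-by-0-or-10 (false ∷ t) k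
  ... | inj₁ k₀  = parsed t k₀ (FinFactor-refl _)
  ... | inj₂ k₁₀ with parsed (t ∷ʳ true) (subst K (sym (++-assoc (false ∷ t) [ true ] [ false ])) k₁₀)
                             (FinFactor-prefix (false ∷ t) [ true ])
  ...   | y , ky , u⊆σy , |y| = y , ky , u⊆σy , trans |y| (cong suc (zeros-∷ʳ1 t))

  desubstitute : ∀ u → K u → ∃ λ y → Lifted y × FinFactor u (σ c y) × length y ≡ startsWith1 u + zeros u
  desubstitute []          k = [] , has-0 , FinFactor-refl [] , refl
  desubstitute (false ∷ t) k = desubstitute₀ t k
  desubstitute (true ∷ t)  k with extendˡ-by-0-or-01 (true ∷ t) k
  ... | inj₂ k₀₁₁ = ⊥-elim (no-11 (infix-closed [ false ] _ t k₀₁₁))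
  ... | inj₁ k₀₁ with desubstitute₀ (true ∷ t) k₀₁
  ...   | y , ky , u⊆σy , |y| =
          y , ky , FinFactor-trans (FinFactor-suffix [ false ] (true ∷ t)) u⊆σy , |y|

  Lifted-prefix : ∀ u s → Lifted (u ++ s) → Lifted u
  Lifted-prefix u []      k = subst Lifted (++-identityʳ u) k
  Lifted-prefix u (x ∷ s) k = prefix-closed (σ c u ∷ʳ false) (σ-tail c x ++ σ c s ∷ʳ false) (subst K (begin
    σ c (u ++ x ∷ s) ∷ʳ false                            ≡⟨ cong (_∷ʳ false) (σ-++ c u (x ∷ s)) ⟩
    (σ c u ++ false ∷ σ-tail c x ++ σ c s) ∷ʳ false      ≡⟨ ++-assoc (σ c u) _ _ ⟩
    σ c u ++ false ∷ (σ-tail c x ++ σ c s) ∷ʳ false      ≡⟨ cong (λ t → σ c u ++ false ∷ t) (++-assoc (σ-tail c x) _ _) ⟩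
    σ c u ++ false ∷ σ-tail c x ++ σ c s ∷ʳ false        ≡⟨ ++-assoc (σ c u) [ false ] _ ⟨
    (σ c u ∷ʳ false) ++ σ-tail c x ++ σ c s ∷ʳ false     ∎) k)
    where open ≡-Reasoning

  Lifted-suffix : ∀ p u → Lifted (p ++ u) → Lifted u
  Lifted-suffix p u k = suffix-closed (σ c p) _
    (subst K (trans (cong (_∷ʳ false) (σ-++ c p u)) (++-assoc (σ c p) (σ c u) [ false ])) k)

  lift : ¬ Lifted (true ∷ true ∷ []) → Language Lifted
  lift no-11′ = record
    { infix-closed = λ p u s k → Lifted-prefix u s (Lifted-suffix p (u ++ s) k)
    ; extendʳ      = extendʳ′
    ; extendˡ      = extendˡ′
    ; has-[]       = has-0
    ; no-11        = no-11′
    }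
    where
    extendʳ′ : ∀ u → Lifted u → ∃ λ a → Lifted (u ∷ʳ a)
    extendʳ′ u k with extendʳ-by-0-or-10 (σ c u ∷ʳ false) k
    ... | inj₁ k₀  = c , subst K (cong (_∷ʳ false) (begin
        σ c u ∷ʳ false          ≡⟨ cong (σ c u ++_) (σ-same c []) ⟨
        σ c u ++ σ c [ c ]      ≡⟨ σ-++ c u [ c ] ⟨
        σ c (u ∷ʳ c)            ∎)) k₀
      where open ≡-Reasoning
    ... | inj₂ k₁₀ = not c , subst K (begin
        (σ c u ∷ʳ false) ++ true ∷ false ∷ []   ≡⟨ ++-assoc (σ c u) [ false ] _ ⟩
        σ c u ++ false ∷ true ∷ false ∷ []      ≡⟨ ++-assoc (σ c u) (false ∷ true ∷ []) [ false ] ⟨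
        (σ c u ++ false ∷ true ∷ []) ∷ʳ false   ≡⟨ cong (λ t → (σ c u ++ t) ∷ʳ false) (σ-other c []) ⟨
        (σ c u ++ σ c [ not c ]) ∷ʳ false       ≡⟨ cong (_∷ʳ false) (σ-++ c u [ not c ]) ⟨
        σ c (u ∷ʳ not c) ∷ʳ false               ∎) k₁₀
      where open ≡-Reasoning
    extendˡ′ : ∀ u → Lifted u → ∃ λ a → Lifted (a ∷ u)
    extendˡ′ u k with extendˡ-by-0-or-01 (σ c u ∷ʳ false) k
    ... | inj₁ k₀  = c     , subst K (cong (_∷ʳ false) (sym (σ-same c u))) k₀
    ... | inj₂ k₀₁ = not c , subst K (cong (_∷ʳ false) (sym (σ-other c u))) k₀₁

-- The factors of h(f)

iter-10 : ∀ k → iter (2 + k) (true ∷ false ∷ []) ≡ iter (2 + k) [ false ] ++ iter k (true ∷ false ∷ [])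
iter-10 k = begin
  iter (2 + k) (true ∷ false ∷ [])    ≡⟨ iter-++ (2 + k) [ true ] [ false ] ⟩
  P ++ A                              ≡⟨ cong (_++ A) (iter-sucʳ (1 + k) [ true ]) ⟩
  B ++ A                              ≡⟨ cong (B ++_) A≡BC ⟩
  B ++ B ++ C                         ≡⟨ cong (λ t → B ++ t ++ C) B≡CD ⟩
  B ++ (C ++ D) ++ C                  ≡⟨ cong (B ++_) (++-assoc C D C) ⟩
  B ++ C ++ D ++ C                    ≡⟨ ++-assoc B C (D ++ C) ⟨
  (B ++ C) ++ D ++ C                  ≡⟨ cong₂ _++_ A≡BC (iter-++ k [ true ]  [ false ]) ⟨
  A ++ iter k (true ∷ false ∷ [])     ∎
  where
  open ≡-Reasoning
  A = iter (2 + k) [ false ]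
  P = iter (2 + k) [ true ]
  B = iter (1 + k) [ false ]
  C = iter k [ false ]
  D = iter k [ true ]
  A≡BC : A ≡ B ++ C
  A≡BC = trans (iter-sucʳ (1 + k) [ false ]) (trans (iter-++ (1 + k) [ false ] [ true ]) (cong (B ++_) (iter-sucʳ k [ true ])))
  B≡CD : B ≡ C ++ D
  B≡CD = trans (iter-sucʳ k [ false ]) (iter-++ k [ false ] [ true ])

iter-00010 : ∀ k → iter (2 + k) (false ∷ false ∷ false ∷ true ∷ false ∷ []) ≡ fibPrefix (2 + k) ⁴ ++ iter k (true ∷ false ∷ [])
iter-00010 k = begin
  iter (2 + k) (false ∷ false ∷ false ∷ true ∷ false ∷ [])   ≡⟨ iter-++ (2 + k) (false ∷ false ∷ false ∷ []) _ ⟩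
  A₀₀₀ ++ iter (2 + k) (true ∷ false ∷ [])                    ≡⟨ cong (A₀₀₀ ++_) (iter-10 k) ⟩
  A₀₀₀ ++ A ++ X                                              ≡⟨ ++-assoc A₀₀₀ A X ⟨
  (A₀₀₀ ++ A) ++ X                                            ≡⟨ cong (_++ X) (iter-++ (2 + k) (false ∷ false ∷ false ∷ []) [ false ]) ⟨
  iter (2 + k) ([ false ] ⁴) ++ X                             ≡⟨ cong (_++ X) (iter-⁴ (2 + k) [ false ]) ⟩
  A ⁴ ++ X                                                    ∎
  where
  open ≡-Reasoning
  A = fibPrefix (2 + k)
  X = iter k (true ∷ false ∷ [])
  A₀₀₀ = iter (2 + k) (false ∷ false ∷ false ∷ [])

fibPrefix-nonempty : ∀ n → ¬ fibPrefix n ≡ []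
fibPrefix-nonempty n = iter-nonempty n (λ ())

FibFactor : List Bool → Set
FibFactor y = ∃ λ m → FinFactor y (fibPrefix m)

FibFactor-mono : ∀ {u v} → FinFactor u v → FibFactor v → FibFactor u
FibFactor-mono u⊆v (m , v⊆) = m , FinFactor-trans u⊆v v⊆

FibFactor-φ : ∀ {y} → FibFactor y → FibFactor (σ true y)
FibFactor-φ (m , y⊆) = suc m , subst (FinFactor _) (sym (φ≗σ (fibPrefix m))) (FinFactor-map (σ-block true) y⊆)

FibFactor-fibPrefix4 : ∀ y → {True (infix? _≟ᵇ_ y (fibPrefix 4))} → FibFactor y
FibFactor-fibPrefix4 y {y⊆} = 4 , Infix⇒FinFactor (toWitness y⊆)

zeros≤length : ∀ u → zeros u ≤ length u
zeros≤length []          = z≤n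
zeros≤length (false ∷ u) = s≤s (zeros≤length u)
zeros≤length (true  ∷ u) = ℕ.m≤n⇒m≤1+n (zeros≤length u)

σ-nonempty : ∀ c {A} → ¬ A ≡ [] → ¬ σ c A ≡ []
σ-nonempty c {[]}    A≢[] = A≢[]
σ-nonempty c {_ ∷ _} _    ()

module FactorsOfHF {L : List Bool → Set} (lang : Language L)
  (no-01010   : ¬ L (false ∷ true ∷ false ∷ true ∷ false ∷ []))
  (no-⁴       : ∀ A → ¬ A ≡ [] → ¬ L (A ⁴))
  (no-1001001 : ¬ L w1001001) where

  open Language

  -- M j is L desubstituted once by h and then j times by φ.
  M : ℕ → List Bool → Set
  M zero    y = L (σ false y ∷ʳ false)
  M (suc j) y = M j (σ true y ∷ʳ false)

  M-lift : ∀ j y → M j y → ∃ λ s → L (σ false (iter j y) ++ s)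
  M-lift zero    y m = [ false ] , m
  M-lift (suc j) y m with M-lift j (σ true y ∷ʳ false) m
  ... | s , l = σ false (iter j [ false ]) ++ s , subst L (begin
    σ false (iter j (σ true y ∷ʳ false)) ++ s
      ≡⟨ cong (λ t → σ false t ++ s) (iter-++ j (σ true y) [ false ]) ⟩
    σ false (iter j (σ true y) ++ iter j [ false ]) ++ s
      ≡⟨ cong (λ t → σ false (iter j t ++ iter j [ false ]) ++ s) (φ≗σ y) ⟨
    σ false (iter j (φ y) ++ iter j [ false ]) ++ s
      ≡⟨ cong (λ t → σ false (t ++ iter j [ false ]) ++ s) (iter-sucʳ j y) ⟨
    σ false (iter (suc j) y ++ iter j [ false ]) ++ s
      ≡⟨ cong (_++ s) (σ-++ false (iter (suc j) y) _) ⟩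
    (σ false (iter (suc j) y) ++ σ false (iter j [ false ])) ++ s
      ≡⟨ ++-assoc (σ false (iter (suc j) y)) _ s ⟩
    σ false (iter (suc j) y) ++ σ false (iter j [ false ]) ++ s ∎) l
    where open ≡-Reasoning

  M-no⁴ : ∀ j y A → ¬ A ≡ [] → FinFactor (A ⁴) (iter j y) → ¬ M j y
  M-no⁴ j y A A≢[] A⁴⊆ m with M-lift j y m
  ... | s , l = no-⁴ (σ false A) (σ-nonempty false A≢[])
                  (mono lang (FinFactor-++ʳ s (subst (λ t → FinFactor t _) (σ-⁴ false A) (FinFactor-map (σ-block false) A⁴⊆))) l)

  M-language : ∀ j → Language (M j)
  M-no-000   : ∀ j → ¬ M j (false ∷ false ∷ false ∷ [])

  M-language zero    = Desubstitution.lift lang false no-01010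
  M-language (suc j) = Desubstitution.lift (M-language j) true (M-no-000 j)

  M-no-000 zero          = no-⁴ [ false ] (λ ())
  M-no-000 (suc zero)    = no-1001001 ∘ infix-closed lang (false ∷ false ∷ []) w1001001 (false ∷ false ∷ [])
  M-no-000 (suc (suc k)) m with extendʳ-by-0-or-10 (M-language (2 + k)) (false ∷ false ∷ false ∷ []) m
  ... | inj₁ m₀₀₀₀  = M-no⁴ (2 + k) ([ false ] ⁴) (fibPrefix (2 + k)) (fibPrefix-nonempty (2 + k))
                        (subst (FinFactor _) (sym (iter-⁴ (2 + k) [ false ])) (FinFactor-refl _)) m₀₀₀₀
  ... | inj₂ m₀₀₀₁₀ = M-no⁴ (2 + k) (false ∷ false ∷ false ∷ true ∷ false ∷ []) (fibPrefix (2 + k)) (fibPrefix-nonempty (2 + k))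
                        (subst (FinFactor _) (sym (iter-00010 k)) (FinFactor-prefix _ _)) m₀₀₀₁₀

  open Desubstitution using (desubstitute)

  desubstitute-shorter : ∀ j a b c d r → M j (a ∷ b ∷ c ∷ d ∷ r) →
                         startsWith1 (a ∷ b ∷ c ∷ d ∷ r) + zeros (a ∷ b ∷ c ∷ d ∷ r) < length (a ∷ b ∷ c ∷ d ∷ r)
  desubstitute-shorter j false false false d r m = ⊥-elim (M-no-000 j (prefix-closed (M-language j) _ (d ∷ r) m))
  desubstitute-shorter j false false true  d r m = s≤s (s≤s (s≤s (zeros≤length (d ∷ r))))
  desubstitute-shorter j false true  c     d r m = s≤s (s≤s (zeros≤length (c ∷ d ∷ r)))
  desubstitute-shorter j true  false false false r m = ⊥-elim (M-no-000 j (infix-closed (M-language j) [ true ] _ r m))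
  desubstitute-shorter j true  false false true  r m = s≤s (s≤s (s≤s (s≤s (zeros≤length r))))
  desubstitute-shorter j true  false true  d r m = s≤s (s≤s (s≤s (zeros≤length (d ∷ r))))
  desubstitute-shorter j true  true  c     d r m = s≤s (s≤s (zeros≤length (c ∷ d ∷ r)))

  -- The words of length at most 3 avoiding 11 and 000 all occur in φ⁴(0) = 01001010.
  M-factors : ∀ j y → Acc _<_ (length y) → M j y → FibFactor y
  M-factors j []                          _ _ = FibFactor-fibPrefix4 []
  M-factors j (false ∷ [])                _ _ = FibFactor-fibPrefix4 (false ∷ [])
  M-factors j (true ∷ [])                 _ _ = FibFactor-fibPrefix4 (true ∷ [])
  M-factors j (false ∷ false ∷ [])        _ _ = FibFactor-fibPrefix4 (false ∷ false ∷ [])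
  M-factors j (false ∷ true ∷ [])         _ _ = FibFactor-fibPrefix4 (false ∷ true ∷ [])
  M-factors j (true ∷ false ∷ [])         _ _ = FibFactor-fibPrefix4 (true ∷ false ∷ [])
  M-factors j (false ∷ false ∷ true ∷ [])  _ _ = FibFactor-fibPrefix4 (false ∷ false ∷ true ∷ [])
  M-factors j (false ∷ true ∷ false ∷ [])  _ _ = FibFactor-fibPrefix4 (false ∷ true ∷ false ∷ [])
  M-factors j (true ∷ false ∷ false ∷ [])  _ _ = FibFactor-fibPrefix4 (true ∷ false ∷ false ∷ [])
  M-factors j (true ∷ false ∷ true ∷ [])   _ _ = FibFactor-fibPrefix4 (true ∷ false ∷ true ∷ [])
  M-factors j (false ∷ false ∷ false ∷ []) _ m = ⊥-elim (M-no-000 j m)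
  M-factors j (true ∷ true ∷ r)           _ m = ⊥-elim (no-11 (M-language j) (prefix-closed (M-language j) _ r m))
  M-factors j (x ∷ true ∷ true ∷ r)       _ m = ⊥-elim (no-11 (M-language j) (infix-closed (M-language j) [ x ] _ r m))
  M-factors j y@(a ∷ b ∷ c ∷ d ∷ r) (acc smaller) m with desubstitute (M-language j) true y m
  ... | z , mz , y⊆σz , |z| = FibFactor-mono y⊆σz (FibFactor-φ (M-factors (suc j) z (smaller z<y) mz))
    where
    z<y : length z < length y
    z<y = subst (_< length y) (sym |z|) (desubstitute-shorter j a b c d r m)

  L⊆factors-h[f] : ∀ u → L u → ∃ λ m → FinFactor u (h (fibPrefix m))
  L⊆factors-h[f] u l with desubstitute lang false u l
  ... | y , my , u⊆σy , _ with M-factors zero y (<-wellFounded (length y)) my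
  ...   | m , y⊆ = m , subst (FinFactor u) (sym (h≗σ (fibPrefix m))) (FinFactor-trans u⊆σy (FinFactor-map (σ-block false) y⊆))

  factors-h[f]⊆L : ∀ u m → FinFactor u (h (fibPrefix m)) → L u
  factors-h[f]⊆L u m u⊆ with M-lift m [ false ] (has-0 (M-language m))
  ... | s , l = mono lang (FinFactor-++ʳ s (subst (FinFactor u) (h≗σ (fibPrefix m)) u⊆)) l

-- The Fibonacci word

fibPrefix-suc : ∀ n → fibPrefix (suc n) ≡ fibPrefix n ++ iter n [ true ]
fibPrefix-suc n = trans (iter-sucʳ n [ false ]) (iter-++ n [ false ] [ true ])

fibPrefix-mono : ∀ m d → ∃ λ r → fibPrefix (m + d) ≡ fibPrefix m ++ r
fibPrefix-mono m zero    = [] , trans (cong fibPrefix (ℕ.+-identityʳ m)) (sym (++-identityʳ _))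
fibPrefix-mono m (suc d) with fibPrefix-mono m d
... | r , eq = r ++ iter (m + d) [ true ] , (begin
  fibPrefix (m + suc d)                           ≡⟨ cong fibPrefix (ℕ.+-suc m d) ⟩
  fibPrefix (suc (m + d))                         ≡⟨ fibPrefix-suc (m + d) ⟩
  fibPrefix (m + d) ++ iter (m + d) [ true ]      ≡⟨ cong (_++ _) eq ⟩
  (fibPrefix m ++ r) ++ iter (m + d) [ true ]     ≡⟨ ++-assoc (fibPrefix m) r _ ⟩
  fibPrefix m ++ r ++ iter (m + d) [ true ]       ∎)
  where open ≡-Reasoning

length-fibPrefix : ∀ n → suc n ≤ length (fibPrefix n)
length-fibPrefix zero    = s≤s z≤n
length-fibPrefix (suc n) = subst (suc (suc n) ≤_) (sym (trans (cong length (fibPrefix-suc n)) (length-++ (fibPrefix n))))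
  (subst (_≤ length (fibPrefix n) + length (iter n [ true ])) (ℕ.+-comm (suc n) 1)
    (ℕ.+-mono-≤ (length-fibPrefix n) (nonempty⇒1≤length (iter-nonempty n (λ ())))))
  where
  nonempty⇒1≤length : ∀ {xs : List Bool} → ¬ xs ≡ [] → 1 ≤ length xs
  nonempty⇒1≤length {[]}    xs≢[] = ⊥-elim (xs≢[] refl)
  nonempty⇒1≤length {_ ∷ _} _     = s≤s z≤n

nthD-++ˡ : ∀ (a b : List Bool) {k} → k < length a → nthD (a ++ b) k ≡ nthD a k
nthD-++ˡ (x ∷ a) b {zero}  _         = refl
nthD-++ˡ (x ∷ a) b {suc k} (s≤s k<a) = nthD-++ˡ a b k<a

nthD-fibPrefix : ∀ m {k} → k < length (fibPrefix m) → nthD (fibPrefix m) k ≡ fib k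
nthD-fibPrefix m {k} k<m with fibPrefix-mono m (suc k) | fibPrefix-mono (suc k) m
... | r , eq | r′ , eq′ = begin
  nthD (fibPrefix m) k                 ≡⟨ nthD-++ˡ (fibPrefix m) r k<m ⟨
  nthD (fibPrefix m ++ r) k            ≡⟨ cong (λ v → nthD v k) (trans (sym eq) (cong fibPrefix (ℕ.+-comm m (suc k)))) ⟩
  nthD (fibPrefix (suc k + m)) k       ≡⟨ cong (λ v → nthD v k) eq′ ⟩
  nthD (fibPrefix (suc k) ++ r′) k     ≡⟨ nthD-++ˡ (fibPrefix (suc k)) r′ (ℕ.≤-trans (ℕ.n≤1+n (suc k)) (length-fibPrefix (suc k))) ⟩
  fib k                                ∎
  where open ≡-Reasoning

applyUpTo-nthD : ∀ (xs : List Bool) (g : ℕ → Bool) → (∀ {k} → k < length xs → nthD xs k ≡ g k) →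
                 applyUpTo g (length xs) ≡ xs
applyUpTo-nthD []       g agree = refl
applyUpTo-nthD (x ∷ xs) g agree = cong₂ _∷_ (sym (agree (s≤s z≤n))) (applyUpTo-nthD xs (g ∘ suc) (agree ∘ s≤s))

fibTake-fibPrefix : ∀ m → fibTake (length (fibPrefix m)) ≡ fibPrefix m
fibTake-fibPrefix m = trans (map-upTo fib _) (applyUpTo-nthD (fibPrefix m) fib (nthD-fibPrefix m))

fibTake-prefix : ∀ n → ∃ λ r → fibPrefix n ≡ fibTake n ++ r
fibTake-prefix n = rest , (begin
  fibPrefix n                         ≡⟨ fibTake-fibPrefix n ⟨
  fibTake (length (fibPrefix n))      ≡⟨ cong fibTake (ℕ.m+[n∸m]≡n (ℕ.<⇒≤ (length-fibPrefix n))) ⟨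
  fibTake (n + d)                     ≡⟨ map-upTo fib (n + d) ⟩
  applyUpTo fib (n + d)               ≡⟨ applyUpTo-++ fib n d ⟩
  applyUpTo fib n ++ rest             ≡⟨ cong (_++ rest) (map-upTo fib n) ⟨
  fibTake n ++ rest                   ∎)
  where
  open ≡-Reasoning
  d = length (fibPrefix n) ∸ n
  rest = applyUpTo (λ k → fib (n + k)) d

FactorHF⇔ : ∀ u → FactorHF u ⇔ (∃ λ m → FinFactor u (h (fibPrefix m)))
FactorHF⇔ u = mk⇔ to from
  where
  to : FactorHF u → ∃ λ m → FinFactor u (h (fibPrefix m))
  to (n , u⊆) with fibTake-prefix n
  ... | r , eq = n , FinFactor-trans u⊆ (subst (λ v → FinFactor (h (fibTake n)) (h v)) (sym eq)
                                                (FinFactor-map _ (FinFactor-prefix (fibTake n) r)))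
  from : (∃ λ m → FinFactor u (h (fibPrefix m))) → FactorHF u
  from (m , u⊆) = length (fibPrefix m) , subst (FinFactor u ∘ h) (sym (fibTake-fibPrefix m)) u⊆

factorLanguage : ∀ {w} → ¬ Factor (true ∷ true ∷ []) w → Language (λ u → Factor u w)
factorLanguage {w} no-11 = record
  { infix-closed = λ p u s → Factor-mono {w} (p , s , refl)
  ; extendʳ      = Factor-extendʳ {w}
  ; extendˡ      = Factor-extendˡ {w}
  ; has-[]       = + 0 , refl
  ; no-11        = no-11
  }

SameFactors-h[f] : ∀ w → ¬ Factor (true ∷ true ∷ []) w → ¬ Factor (false ∷ true ∷ false ∷ true ∷ false ∷ []) w →
                   (∀ A → ¬ A ≡ [] → ¬ Factor (A ⁴) w) → ¬ Factor w1001001 w → SameFactors w FactorHF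
SameFactors-h[f] w no-11 no-01010 no-⁴ no-1001001 u =
  (λ u∈w → from (L⊆factors-h[f] u u∈w)) , (λ u∈hf → let m , u⊆ = to u∈hf in factors-h[f]⊆L u m u⊆)
  where
  open FactorsOfHF (factorLanguage {w} no-11) no-01010 no-⁴ no-1001001
  open Equivalence (FactorHF⇔ u)

SameFactors-compl : ∀ {w P} → SameFactors (not ∘ w) P → SameFactors w (P ∘ compl)
SameFactors-compl {w} same u =
  (λ u∈w → proj₁ (same (compl u)) (Factor-compl {w} u∈w)) ,
  (λ p → subst (λ v → Factor v w) (compl-involutive u) (Factor-compl⁻ {w} (proj₂ (same (compl u)) p)))

module Admissible (w : BiWord)
  (four-free  : FourFree w)
  (no-pair    : ¬ (∃ λ (x : List Bool) → (length x ≡ 4) × Factor x w × Factor (compl x) w))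
  (no-1001001 : ¬ Factor w1001001 w)
  (no-0110110 : ¬ Factor w0110110 w) where

  factors-not-Forbidden : ∀ {v} → Factor v w → ¬ Forbidden v
  factors-not-Forbidden v∈w (inj₁ (A , A≢[] , A⁴⊆v))            = FourFree⇒no⁴ {w} four-free A A≢[] (Factor-mono {w} A⁴⊆v v∈w)
  factors-not-Forbidden v∈w (inj₂ (inj₁ (x , |x| , x⊆v , x̄⊆v))) = no-pair (x , |x| , Factor-mono {w} x⊆v v∈w , Factor-mono {w} x̄⊆v v∈w)
  factors-not-Forbidden v∈w (inj₂ (inj₂ (inj₁ u⊆v)))            = no-1001001 (Factor-mono {w} u⊆v v∈w)
  factors-not-Forbidden v∈w (inj₂ (inj₂ (inj₂ u⊆v)))            = no-0110110 (Factor-mono {w} u⊆v v∈w)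

  no-alternating : ∀ b → ¬ Factor (b ∷ not b ∷ b ∷ not b ∷ b ∷ []) w
  no-alternating false f = no-pair (_ , refl , Factor-mono {w} (FinFactor-prefix _ [ false ]) f , Factor-mono {w} (FinFactor-suffix [ false ] _) f)
  no-alternating true  f = no-pair (_ , refl , Factor-mono {w} (FinFactor-prefix _ [ true ]) f , Factor-mono {w} (FinFactor-suffix [ true ] _) f)

  no⁴-compl : ∀ A → ¬ A ≡ [] → ¬ Factor (A ⁴) (not ∘ w)
  no⁴-compl []      A≢[] _ = A≢[] refl
  no⁴-compl (x ∷ A) _    f = FourFree⇒no⁴ {w} four-free (compl (x ∷ A)) (λ ())
                               (subst (λ v → Factor v w) (compl-⁴ (x ∷ A)) (Factor-compl⁻ {w} f))

  no-11⇒h[f] : ¬ Factor (true ∷ true ∷ []) w → SameFactors w FactorHF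
  no-11⇒h[f] no-11 = SameFactors-h[f] w no-11 (no-alternating false) (FourFree⇒no⁴ {w} four-free) no-1001001

  no-00⇒h[f]bar : ¬ Factor (false ∷ false ∷ []) w → SameFactors w FactorHFbar
  no-00⇒h[f]bar no-00 = SameFactors-compl {w} (SameFactors-h[f] (not ∘ w) (no-00 ∘ Factor-compl⁻ {w})
                          (no-alternating true ∘ Factor-compl⁻ {w}) no⁴-compl (no-0110110 ∘ Factor-compl⁻ {w}))

lemma15 : (w : BiWord) → FourFree w
    → ¬ (∃ λ (x : List Bool) → (length x ≡ 4) × Factor x w × Factor (compl x) w)
    → ¬ Factor (true ∷ false ∷ false ∷ true ∷ false ∷ false ∷ true ∷ []) w
    → ¬ Factor (false ∷ true ∷ true ∷ false ∷ true ∷ true ∷ false ∷ []) w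
    → SameFactors w FactorHF ⊎ SameFactors w FactorHFbar
lemma15 w four-free no-pair no-1001001 no-0110110 =
  Sum.map no-11⇒h[f] no-00⇒h[f]bar (no-11-or-no-00 {w} factors-not-Forbidden)
  where open Admissible w four-free no-pair no-1001001 no-0110110
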